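{- Let $m\ge1$ and $n\ge1$ be integers. Then \[ T^{(m)}_{n,n-1}=\prod_{j=1}^{n-1}\bigl(j(m-1)+1\bigr)=m\,(2(m-1)+1)\cdots((n-1)(m-1)+1), \qquad T^{(m)}_{n,1}=m\,(2^n-n-1). \]
   Context: Let $m\ge1$, $n\ge1$ be integers. An $m$-Stirling permutation of order $n$ is a word $a_1a_2\cdots a_{mn}$ that is a permutation of the multiset in which each of $1,2,\dots,n$ occurs exactly $m$ times, such that whenever $u<v<w$ and $a_u=a_w$, one has $a_u\ge a_v$. A descent of such a word is an index $j\in\{1,\dots,mn-1\}$ with $a_j>a_{j+1}$. The $m$th-order Eulerian number $T^{(m)}_{n,k}$ is the number of $m$-Stirling permutations of order $n$ with exactly $k$ descents; by convention $T^{(m)}_{n,k}=0$ for $k<0$ or $k\ge n$, and $T^{(m)}_{1,0}=1$. -}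

module Defs where

open import Data.Bool using (Bool; true; false; _∧_; _∨_; not; if_then_else_)
open import Data.Nat using (ℕ; zero; suc; _+_; _*_; _∸_; _^_; _<ᵇ_; _≡ᵇ_)
open import Data.Nat.Properties using (_≟_; _≤?_)
open import Data.Fin using (Fin) renaming (_<?_ to _<ᶠ?_)
open import Data.List using (List; []; _∷_; [_]; map; concatMap; upTo; allFin; filterᵇ; length)
open import Data.Bool.ListAction using (all)
open import Data.Nat.ListAction using (product)
open import Data.Vec using (Vec; lookup; toList) renaming ([] to []ᵥ; _∷_ to _∷ᵥ_)
open import Relation.Nullary.Decidable using (⌊_⌋)

words : (L n : ℕ) → List (Vec ℕ L)
words zero    n = [ []ᵥ ]
words (suc L) n = concatMap (λ x → map (x ∷ᵥ_) (words L n)) (map suc (upTo n))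

occ : ℕ → List ℕ → ℕ
occ i []      = 0
occ i (x ∷ w) = (if x ≡ᵇ i then 1 else 0) + occ i w

isMultisetPerm : (m n : ℕ) → List ℕ → Bool
isMultisetPerm m n w = all (λ i → occ i w ≡ᵇ m) (map suc (upTo n))

allF : ∀ {L} → (Fin L → Bool) → Bool
allF {L} p = all p (allFin L)

isStirlingCond : ∀ {L} → Vec ℕ L → Bool
isStirlingCond a =
  allF λ u → allF λ v → allF λ w →
    not (⌊ u <ᶠ? v ⌋ ∧ ⌊ v <ᶠ? w ⌋ ∧ ⌊ lookup a u ≟ lookup a w ⌋)
    ∨ ⌊ lookup a v ≤? lookup a u ⌋

descents : List ℕ → ℕ
descents (x ∷ y ∷ r) = (if y <ᵇ x then 1 else 0) + descents (y ∷ r)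
descents _           = 0

isMStirling : (m n : ℕ) → Vec ℕ (m * n) → Bool
isMStirling m n a = isMultisetPerm m n (toList a) ∧ isStirlingCond a

Eul : (m n k : ℕ) → ℕ
Eul m n k = length (filterᵇ (λ a → isMStirling m n a ∧ (descents (toList a) ≡ᵇ k)) (words (m * n) n))

prodFormula : (m n : ℕ) → ℕ
prodFormula m n = product (map (λ j → j * (m ∸ 1) + 1) (map suc (upTo (n ∸ 1))))

module Submission where

-- In an m-Stirling permutation every letter strictly between two copies of the smallest letter 1
-- would have to be at most 1, so the m copies of 1 form one contiguous block.  Deleting the block and
-- lowering every other letter by one therefore yields an m-Stirling permutation of order n together
-- with one of the mn + 1 gaps where the block sat, and every such pair arises exactly once.  Putting
-- the block in front, or right after one of the d descent tops, keeps the d descents; each of the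
-- other mn − d gaps creates one more.  Hence
--   T(n+1, k) = (k+1) T(n, k) + (mn − k + 1) T(n, k−1),
-- and both formulas follow by induction on n: for k = n only the second term survives, and for k = 1
-- the recurrence reads T(n+1, 1) = 2 T(n, 1) + mn.

open import Defs
open import Data.Bool using (Bool; true; false; T; _∧_; _∨_; not; if_then_else_)
open import Data.Bool.Properties using (T?; T-∧; T-≡; ∨-zeroʳ; ∨-identityʳ; ∧-zeroʳ)
open import Data.Bool.ListAction using (all; and)
open import Data.Nat
  using (ℕ; zero; suc; pred; _+_; _*_; _∸_; _^_; _≡ᵇ_; _≤ᵇ_; _<ᵇ_; _≤_; _<_; z≤n; s≤s)
open import Data.Nat.Properties
  using ( _≟_; _≤?_; ≡ᵇ⇒≡; ≡⇒≡ᵇ; suc-injective; >⇒≢; <⇒≢; ≤-refl; ≤-trans; ≤-pred; m≤n⇒m≤1+n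
        ; +-comm; +-identityʳ; +-cancelˡ-≡; *-comm; *-identityˡ; *-identityʳ; *-zeroʳ; *-suc
        ; 0∸n≡0; m+n∸n≡m; +-∸-assoc; ∸-+-assoc; *-distribˡ-∸ )
open import Data.Nat.ListAction using (sum; product)
open import Data.Nat.ListAction.Properties using (product-++)
open import Data.Nat.Tactic.RingSolver using (solve-∀)
open import Data.Fin using (Fin) renaming (zero to fzero; suc to fsuc; _<?_ to _<ᶠ?_)
open import Data.Vec using (Vec; lookup; toList) renaming ([] to []ᵥ; _∷_ to _∷ᵥ_)
open import Data.List
  using (List; []; _∷_; [_]; _++_; map; concatMap; length; filterᵇ; replicate; allFin; upTo; applyUpTo)
open import Data.List.Properties
  using ( length-++; length-map; length-replicate; map-∘; map-++; map-id; map-cong; map-cong-local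
        ; map-injective; map-replicate; map-tabulate; map-concatMap; concatMap-cong; map-applyUpTo
        ; map-upTo; upTo-∷ʳ; ∷-injective; ∷-injectiveʳ; ++-cancelˡ; filter-++; filter-≐; filter-none )
open import Data.List.Relation.Unary.All as All using (All; []; _∷_)
import Data.List.Relation.Unary.All.Properties as All
open import Data.List.Relation.Unary.AllPairs using ([]; _∷_)
open import Data.List.Relation.Unary.Any using (here; there)
open import Data.List.Relation.Unary.Unique.Propositional using (Unique)
open import Data.List.Relation.Unary.Unique.Propositional.Properties
  using (++⁺; upTo⁺; applyUpTo⁺₁) renaming (map⁺ to Unique-map⁺; filter⁺ to Unique-filter⁺)
open import Data.List.Relation.Binary.Disjoint.Propositional using (Disjoint)
open import Data.List.Membership.Propositional using (_∈_; find; lose)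
open import Data.List.Membership.Propositional.Properties
  using ( ∈-map⁺; ∈-map⁻; ∈-upTo⁺; ∈-upTo⁻; ∈-applyUpTo⁺; ∈-applyUpTo⁻; ∈-concatMap⁺; ∈-concatMap⁻
        ; ∈-filter⁺; ∈-filter⁻ )
open import Data.List.Membership.Propositional.Properties.WithK using (unique∧set⇒bag)
open import Data.List.Relation.Binary.BagAndSetEquality using (∼bag⇒↭)
open import Data.List.Relation.Binary.Permutation.Propositional
  using (_↭_; ↭-refl; ↭-reflexive; ↭-prep; ↭-sym; ↭-trans)
open import Data.List.Relation.Binary.Permutation.Propositional.Properties
  using (↭-length; filter-↭; shift; All-resp-↭) renaming (map⁺ to ↭-map⁺)
open import Data.Product using (_×_; _,_; proj₁; proj₂; ∃; ∃₂)
open import Data.Unit using (tt)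
open import Function using (_∘_; _⇔_; mk⇔; Equivalence)
open import Relation.Binary.PropositionalEquality
  using (_≡_; _≗_; refl; sym; trans; cong; cong₂; subst; module ≡-Reasoning)
open import Relation.Nullary.Decidable using (⌊_⌋; isYes≗does)
open import Relation.Nullary.Negation using (contradiction)

module _ {A : Set} (p : A → Bool) where

  length-filterᵇ-↭ : {xs ys : List A} → xs ↭ ys → length (filterᵇ p xs) ≡ length (filterᵇ p ys)
  length-filterᵇ-↭ xs↭ys = ↭-length (filter-↭ (T? ∘ p) xs↭ys)

  unique∧set⇒length-filterᵇ-≡ : {xs ys : List A} → Unique xs → Unique ys →
    (∀ {z} → z ∈ xs ⇔ z ∈ ys) → length (filterᵇ p xs) ≡ length (filterᵇ p ys)
  unique∧set⇒length-filterᵇ-≡ xs! ys! xs≈ys =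
    length-filterᵇ-↭ (∼bag⇒↭ (unique∧set⇒bag xs! ys! xs≈ys))

  length-filterᵇ-++ : (xs ys : List A) →
    length (filterᵇ p (xs ++ ys)) ≡ length (filterᵇ p xs) + length (filterᵇ p ys)
  length-filterᵇ-++ xs ys = trans (cong length (filter-++ (T? ∘ p) xs ys)) (length-++ (filterᵇ p xs))

  sum-map-if : (c : ℕ) (xs : List A) →
    sum (map (λ x → if p x then c else 0) xs) ≡ c * length (filterᵇ p xs)
  sum-map-if c []       = sym (*-zeroʳ c)
  sum-map-if c (x ∷ xs) with p x
  ... | true  = trans (cong (c +_) (sum-map-if c xs)) (sym (*-suc c _))
  ... | false = sum-map-if c xs

module _ {A : Set} where

  filterᵇ-cong : {p q : A → Bool} → p ≗ q → filterᵇ p ≗ filterᵇ q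
  filterᵇ-cong {p} {q} p≗q =
    filter-≐ (T? ∘ p) (T? ∘ q) ((λ {x} → subst T (p≗q x)) , (λ {x} → subst T (sym (p≗q x))))

  filterᵇ-∧ : (p q : A → Bool) (xs : List A) →
    filterᵇ (λ x → p x ∧ q x) xs ≡ filterᵇ q (filterᵇ p xs)
  filterᵇ-∧ p q []       = refl
  filterᵇ-∧ p q (x ∷ xs) with p x
  ... | false = filterᵇ-∧ p q xs
  ... | true with q x
  ...   | true  = cong (x ∷_) (filterᵇ-∧ p q xs)
  ...   | false = filterᵇ-∧ p q xs

  sum-map-+ : (f g : A → ℕ) (xs : List A) →
    sum (map (λ x → f x + g x) xs) ≡ sum (map f xs) + sum (map g xs)
  sum-map-+ f g []       = refl
  sum-map-+ f g (x ∷ xs) =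
    trans (cong (f x + g x +_) (sum-map-+ f g xs)) (interchange (f x) (g x) _ _)
    where
    interchange : ∀ a b c d → a + b + (c + d) ≡ a + c + (b + d)
    interchange = solve-∀

module _ {A B : Set} where

  length-filterᵇ-map : (p : B → Bool) (f : A → B) (xs : List A) →
    length (filterᵇ p (map f xs)) ≡ length (filterᵇ (p ∘ f) xs)
  length-filterᵇ-map p f []       = refl
  length-filterᵇ-map p f (x ∷ xs) with p (f x)
  ... | true  = cong suc (length-filterᵇ-map p f xs)
  ... | false = length-filterᵇ-map p f xs

  length-filterᵇ-concatMap : (p : B → Bool) (f : A → List B) (xs : List A) →
    length (filterᵇ p (concatMap f xs)) ≡ sum (map (λ x → length (filterᵇ p (f x))) xs)
  length-filterᵇ-concatMap p f []       = refl
  length-filterᵇ-concatMap p f (x ∷ xs) =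
    trans (length-filterᵇ-++ p (f x) (concatMap f xs))
          (cong (length (filterᵇ p (f x)) +_) (length-filterᵇ-concatMap p f xs))

  Unique-concatMap : (f : A → List B) {xs : List A} → Unique xs →
    (∀ {x} → x ∈ xs → Unique (f x)) →
    (∀ {x y z} → x ∈ xs → y ∈ xs → z ∈ f x → z ∈ f y → x ≡ y) →
    Unique (concatMap f xs)
  Unique-concatMap f {[]}     []           _  _      = []
  Unique-concatMap f {x ∷ xs} (x∉xs ∷ xs!) f! shared =
    ++⁺ (f! (here refl))
        (Unique-concatMap f xs! (f! ∘ there) (λ x∈ y∈ → shared (there x∈) (there y∈)))
        disjoint
    where
    disjoint : Disjoint (f x) (concatMap f xs)
    disjoint (z∈fx , z∈rest) with y , y∈xs , z∈fy ← find (∈-concatMap⁻ f z∈rest) =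
      All.lookup x∉xs y∈xs (shared (here refl) (there y∈xs) z∈fx z∈fy)

length-filterᵇ-replicate : (k a v : ℕ) →
  length (filterᵇ (_≡ᵇ k) (replicate a v)) ≡ (if v ≡ᵇ k then a else 0)
length-filterᵇ-replicate k zero    v with v ≡ᵇ k
... | true  = refl
... | false = refl
length-filterᵇ-replicate k (suc a) v with v ≡ᵇ k | length-filterᵇ-replicate k a v
... | true  | ih = cong suc ih
... | false | ih = ih

if-≡ᵇ-subst : (v k : ℕ) (f : ℕ → ℕ) → (if v ≡ᵇ k then f v else 0) ≡ (if v ≡ᵇ k then f k else 0)
if-≡ᵇ-subst v k f with v ≡ᵇ k in eq
... | true  = cong f (≡ᵇ⇒≡ v k (subst T (sym eq) tt))
... | false = refl

wordList : ℕ → ℕ → List (List ℕ)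
wordList zero    n = [ [] ]
wordList (suc L) n = concatMap (λ x → map (x ∷_) (wordList L n)) (map suc (upTo n))

map-toList-words : ∀ L n → map toList (words L n) ≡ wordList L n
map-toList-words zero    n = refl
map-toList-words (suc L) n =
  trans (map-concatMap toList (λ x → map (x ∷ᵥ_) (words L n)) (map suc (upTo n)))
        (concatMap-cong (λ x → trans (sym (map-∘ (words L n)))
                                     (trans (map-∘ (words L n)) (cong (map (x ∷_)) (map-toList-words L n))))
                        (map suc (upTo n)))

Letter : ℕ → ℕ → Set
Letter n x = 1 ≤ x × x ≤ n

Letter-suc : ∀ {n x} → Letter n x → Letter (suc n) (suc x)
Letter-suc (_ , x≤n) = s≤s z≤n , s≤s x≤n

Letter-pred : ∀ {n x} → 1 ≤ x → Letter (suc n) (suc x) → Letter n x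
Letter-pred 1≤x (_ , s≤s x≤n) = 1≤x , x≤n

∈-wordList : ∀ L n {w} → w ∈ wordList L n ⇔ (length w ≡ L × All (Letter n) w)
∈-wordList L n = mk⇔ (to L) (from L)
  where
  to : ∀ L {w} → w ∈ wordList L n → length w ≡ L × All (Letter n) w
  to zero    (here refl) = refl , []
  to (suc L) w∈
    with x , x∈ , w∈x ← find (∈-concatMap⁻ (λ x → map (x ∷_) (wordList L n)) {xs = map suc (upTo n)} w∈)
    with i , i∈ , refl ← ∈-map⁻ suc x∈
    with w′ , w′∈ , refl ← ∈-map⁻ (suc i ∷_) w∈x
    with length≡ , letters ← to L w′∈ = cong suc length≡ , (s≤s z≤n , ∈-upTo⁻ i∈) ∷ letters

  from : ∀ L {w} → length w ≡ L × All (Letter n) w → w ∈ wordList L n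
  from zero    {[]}      (refl , [])                    = here refl
  from (suc L) {suc i ∷ w} (length≡ , (_ , i<n) ∷ letters) =
    ∈-concatMap⁺ (λ x → map (x ∷_) (wordList L n)) {xs = map suc (upTo n)}
      (lose (∈-map⁺ suc (∈-upTo⁺ i<n)) (∈-map⁺ (suc i ∷_) (from L (suc-injective length≡ , letters))))

Unique-wordList : ∀ L n → Unique (wordList L n)
Unique-wordList zero    n = [] ∷ []
Unique-wordList (suc L) n =
  Unique-concatMap (λ x → map (x ∷_) (wordList L n)) (Unique-map⁺ suc-injective (upTo⁺ n))
    (λ _ → Unique-map⁺ ∷-injectiveʳ (Unique-wordList L n)) sameHead
  where
  sameHead : ∀ {x y z} → x ∈ map suc (upTo n) → y ∈ map suc (upTo n) →
    z ∈ map (x ∷_) (wordList L n) → z ∈ map (y ∷_) (wordList L n) → x ≡ y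
  sameHead _ _ z∈x z∈y with _ , _ , refl ← ∈-map⁻ _ z∈x | _ , _ , z≡y∷ ← ∈-map⁻ _ z∈y =
    proj₁ (∷-injective z≡y∷)

occ-filterᵇ : ∀ i w → occ i w ≡ length (filterᵇ (_≡ᵇ i) w)
occ-filterᵇ i []      = refl
occ-filterᵇ i (x ∷ w) with x ≡ᵇ i
... | true  = cong suc (occ-filterᵇ i w)
... | false = occ-filterᵇ i w

occ-↭ : ∀ i {xs ys} → xs ↭ ys → occ i xs ≡ occ i ys
occ-↭ i {xs} {ys} xs↭ys =
  trans (occ-filterᵇ i xs) (trans (length-filterᵇ-↭ (_≡ᵇ i) xs↭ys) (sym (occ-filterᵇ i ys)))

occ-++ : ∀ i xs ys → occ i (xs ++ ys) ≡ occ i xs + occ i ys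
occ-++ i xs ys =
  trans (occ-filterᵇ i (xs ++ ys))
    (trans (length-filterᵇ-++ (_≡ᵇ i) xs ys) (sym (cong₂ _+_ (occ-filterᵇ i xs) (occ-filterᵇ i ys))))

occ-replicate : ∀ i j v → occ i (replicate j v) ≡ (if v ≡ᵇ i then j else 0)
occ-replicate i j v = trans (occ-filterᵇ i (replicate j v)) (length-filterᵇ-replicate i j v)

occ-map-suc : ∀ i w → occ (suc i) (map suc w) ≡ occ i w
occ-map-suc i []      = refl
occ-map-suc i (x ∷ w) = cong ((if x ≡ᵇ i then 1 else 0) +_) (occ-map-suc i w)

occ-absent : ∀ {i w} → All (i <_) w → occ i w ≡ 0
occ-absent []                        = refl
occ-absent {i} {x ∷ w} (i<x ∷ i<w) with x ≡ᵇ i in x≡ᵇi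
... | true  = contradiction (≡ᵇ⇒≡ x i (subst T (sym x≡ᵇi) tt)) (>⇒≢ i<x)
... | false = occ-absent i<w

occ-ones-++ : ∀ j {c} → All (1 <_) c → occ 1 (replicate j 1 ++ c) ≡ j
occ-ones-++ j {c} c>1 =
  trans (occ-++ 1 (replicate j 1) c)
        (trans (cong₂ _+_ (occ-replicate 1 j 1) (occ-absent c>1)) (+-identityʳ j))

all-map : ∀ {A B : Set} (p : B → Bool) (f : A → B) (xs : List A) → all p (map f xs) ≡ all (p ∘ f) xs
all-map p f xs = cong and (sym (map-∘ xs))

isMultisetPerm-upTo : ∀ m n w → isMultisetPerm m n w ≡ all (λ j → occ (suc j) w ≡ᵇ m) (upTo n)
isMultisetPerm-upTo m n w = all-map (λ i → occ i w ≡ᵇ m) suc (upTo n)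

isMultisetPerm-suc : ∀ m n w →
  isMultisetPerm m (suc n) w ≡ (occ 1 w ≡ᵇ m) ∧ all (λ j → occ (suc (suc j)) w ≡ᵇ m) (upTo n)
isMultisetPerm-suc m n w = cong ((occ 1 w ≡ᵇ m) ∧_)
  (trans (cong (all hasM ∘ map suc) (sym (map-upTo suc n)))
         (trans (all-map hasM suc (map suc (upTo n))) (all-map (hasM ∘ suc) suc (upTo n))))
  where
  hasM : ℕ → Bool
  hasM i = occ i w ≡ᵇ m

-- The Stirling condition on lists

infix 4 _∉ᵇ_
_∉ᵇ_ : ℕ → List ℕ → Bool
x ∉ᵇ w = all (λ y → not (x ≡ᵇ y)) w

-- stirlingAt x w is the Stirling condition on x ∷ w restricted to the triples starting at the head x.
stirlingAt : ℕ → List ℕ → Bool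
stirlingAt x []      = true
stirlingAt x (y ∷ w) = ((x ∉ᵇ w) ∨ (y ≤ᵇ x)) ∧ stirlingAt x w

isStirling : List ℕ → Bool
isStirling []      = true
isStirling (x ∷ w) = stirlingAt x w ∧ isStirling w

module _ {L : ℕ} where

  allF-suc : (p : Fin (suc L) → Bool) → allF p ≡ p fzero ∧ allF (p ∘ fsuc)
  allF-suc p =
    cong (λ b → p fzero ∧ and b) (trans (map-tabulate fsuc p) (sym (map-tabulate (λ i → i) (p ∘ fsuc))))

  allF-cong : {p q : Fin L → Bool} → p ≗ q → allF p ≡ allF q
  allF-cong p≗q = cong and (map-cong p≗q (allFin L))

  ⌊suc<ᶠsuc⌋ : (i j : Fin L) → ⌊ fsuc i <ᶠ? fsuc j ⌋ ≡ ⌊ i <ᶠ? j ⌋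
  ⌊suc<ᶠsuc⌋ i j = trans (isYes≗does (fsuc i <ᶠ? fsuc j)) (sym (isYes≗does (i <ᶠ? j)))

allF-suc-true : ∀ {L} (p : Fin (suc L) → Bool) → p fzero ≡ true → allF p ≡ allF (p ∘ fsuc)
allF-suc-true p p0≡true = trans (allF-suc p) (cong (_∧ allF (p ∘ fsuc)) p0≡true)

allF-true : ∀ {L} {p : Fin L → Bool} → (∀ i → p i ≡ true) → allF p ≡ true
allF-true {zero}          _      = refl
allF-true {suc L} {p} p≡true = trans (allF-suc-true p (p≡true fzero)) (allF-true (p≡true ∘ fsuc))

allF-∨ʳ : ∀ {L} (p : Fin L → Bool) (b : Bool) → allF (λ i → p i ∨ b) ≡ allF p ∨ b
allF-∨ʳ p true  = trans (allF-true (λ i → ∨-zeroʳ (p i))) (sym (∨-zeroʳ (allF p)))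
allF-∨ʳ p false = trans (allF-cong (λ i → ∨-identityʳ (p i))) (sym (∨-identityʳ (allF p)))

stirlingAtᵛ : ∀ {L} → ℕ → Vec ℕ L → Bool
stirlingAtᵛ x v =
  allF λ j → allF λ k → not (⌊ j <ᶠ? k ⌋ ∧ ⌊ x ≟ lookup v k ⌋) ∨ ⌊ lookup v j ≤? x ⌋

isStirlingCond-∷ : ∀ {L} x (v : Vec ℕ L) → isStirlingCond (x ∷ᵥ v) ≡ stirlingAtᵛ x v ∧ isStirlingCond v
isStirlingCond-∷ {L} x v =
  trans (allF-suc (λ u → allF λ v′ → allF λ w′ → S u v′ w′)) (cong₂ _∧_ atHead inTail)
  where
  a : Vec ℕ (suc L)
  a = x ∷ᵥ v

  S : Fin (suc L) → Fin (suc L) → Fin (suc L) → Bool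
  S u v′ w′ =
    not (⌊ u <ᶠ? v′ ⌋ ∧ ⌊ v′ <ᶠ? w′ ⌋ ∧ ⌊ lookup a u ≟ lookup a w′ ⌋) ∨ ⌊ lookup a v′ ≤? lookup a u ⌋

  atHead : (allF λ v′ → allF λ w′ → S fzero v′ w′) ≡ stirlingAtᵛ x v
  atHead =
    trans (allF-suc-true (λ v′ → allF λ w′ → S fzero v′ w′) (allF-true {p = S fzero fzero} (λ _ → refl)))
      (allF-cong λ j → trans (allF-suc-true (S fzero (fsuc j)) refl)
        (allF-cong λ k → cong (λ b → not (b ∧ ⌊ x ≟ lookup v k ⌋) ∨ ⌊ lookup v j ≤? x ⌋)
                              (⌊suc<ᶠsuc⌋ j k)))

  inTail : (allF λ u → allF λ v′ → allF λ w′ → S (fsuc u) v′ w′) ≡ isStirlingCond v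
  inTail =
    allF-cong λ u →
      trans (allF-suc-true (λ v′ → allF λ w′ → S (fsuc u) v′ w′)
                           (allF-true {p = S (fsuc u) fzero} (λ _ → refl)))
        (allF-cong λ j →
          trans (allF-suc-true (S (fsuc u) (fsuc j))
                  (cong (λ b → not b ∨ ⌊ lookup v j ≤? lookup v u ⌋) (∧-zeroʳ ⌊ fsuc u <ᶠ? fsuc j ⌋)))
            (allF-cong λ k →
              cong₂ (λ b c → not (b ∧ c ∧ ⌊ lookup v u ≟ lookup v k ⌋) ∨ ⌊ lookup v j ≤? lookup v u ⌋)
                    (⌊suc<ᶠsuc⌋ u j) (⌊suc<ᶠsuc⌋ j k)))

∉ᵇ-toList : ∀ {L} x (v : Vec ℕ L) → allF (λ k → not ⌊ x ≟ lookup v k ⌋) ≡ (x ∉ᵇ toList v)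
∉ᵇ-toList x []ᵥ      = refl
∉ᵇ-toList x (z ∷ᵥ v) =
  trans (allF-suc (λ k → not ⌊ x ≟ lookup (z ∷ᵥ v) k ⌋))
        (cong₂ (λ b c → not b ∧ c) (isYes≗does (x ≟ z)) (∉ᵇ-toList x v))

stirlingAtᵛ-toList : ∀ {L} x (v : Vec ℕ L) → stirlingAtᵛ x v ≡ stirlingAt x (toList v)
stirlingAtᵛ-toList         x []ᵥ      = refl
stirlingAtᵛ-toList {suc L} x (y ∷ᵥ v) = trans (allF-suc (λ j → allF (B j))) (cong₂ _∧_ atFirst atRest)
  where
  B : Fin (suc L) → Fin (suc L) → Bool
  B j k = not (⌊ j <ᶠ? k ⌋ ∧ ⌊ x ≟ lookup (y ∷ᵥ v) k ⌋) ∨ ⌊ lookup (y ∷ᵥ v) j ≤? x ⌋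

  occursLater : Fin (suc L) → Bool
  occursLater k = ⌊ fzero {L} <ᶠ? k ⌋ ∧ ⌊ x ≟ lookup (y ∷ᵥ v) k ⌋

  atFirst : allF (B fzero) ≡ ((x ∉ᵇ toList v) ∨ (y ≤ᵇ x))
  atFirst = trans (allF-∨ʳ (not ∘ occursLater) ⌊ y ≤? x ⌋)
    (cong₂ _∨_ (trans (allF-suc-true (not ∘ occursLater) refl) (∉ᵇ-toList x v)) (isYes≗does (y ≤? x)))

  atRest : (allF λ j → allF (B (fsuc j))) ≡ stirlingAt x (toList v)
  atRest = trans
    (allF-cong λ j → trans (allF-suc-true (B (fsuc j)) refl)
      (allF-cong λ k → cong (λ b → not (b ∧ ⌊ x ≟ lookup v k ⌋) ∨ ⌊ lookup v j ≤? x ⌋)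
                            (⌊suc<ᶠsuc⌋ j k)))
    (stirlingAtᵛ-toList x v)

isStirlingCond-toList : ∀ {L} (a : Vec ℕ L) → isStirlingCond a ≡ isStirling (toList a)
isStirlingCond-toList []ᵥ      = refl
isStirlingCond-toList (x ∷ᵥ v) =
  trans (isStirlingCond-∷ x v) (cong₂ _∧_ (stirlingAtᵛ-toList x v) (isStirlingCond-toList v))
∉ᵇ-map-suc : ∀ x w → (suc x ∉ᵇ map suc w) ≡ (x ∉ᵇ w)
∉ᵇ-map-suc x []      = refl
∉ᵇ-map-suc x (y ∷ w) = cong (not (x ≡ᵇ y) ∧_) (∉ᵇ-map-suc x w)

≤ᵇ-suc : ∀ y x → (suc y ≤ᵇ suc x) ≡ (y ≤ᵇ x)
≤ᵇ-suc zero    x = refl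
≤ᵇ-suc (suc y) x = refl

stirlingAt-map-suc : ∀ x w → stirlingAt (suc x) (map suc w) ≡ stirlingAt x w
stirlingAt-map-suc x []      = refl
stirlingAt-map-suc x (y ∷ w) =
  cong₂ _∧_ (cong₂ _∨_ (∉ᵇ-map-suc x w) (≤ᵇ-suc y x)) (stirlingAt-map-suc x w)

isStirling-map-suc : ∀ w → isStirling (map suc w) ≡ isStirling w
isStirling-map-suc []      = refl
isStirling-map-suc (x ∷ w) = cong₂ _∧_ (stirlingAt-map-suc x w) (isStirling-map-suc w)

∉ᵇ-ones-++ : ∀ x j c → (suc (suc x) ∉ᵇ replicate j 1 ++ c) ≡ (suc (suc x) ∉ᵇ c)
∉ᵇ-ones-++ x zero    c = refl
∉ᵇ-ones-++ x (suc j) c = ∉ᵇ-ones-++ x j c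

stirlingAt-ones-++ : ∀ x j c → stirlingAt (suc x) (replicate j 1 ++ c) ≡ stirlingAt (suc x) c
stirlingAt-ones-++ x zero    c = refl
stirlingAt-ones-++ x (suc j) c =
  trans (cong (_∧ stirlingAt (suc x) (replicate j 1 ++ c)) (∨-zeroʳ (suc x ∉ᵇ replicate j 1 ++ c)))
        (stirlingAt-ones-++ x j c)

All>1⇒1∉ᵇ : ∀ {c} → All (1 <_) c → (1 ∉ᵇ c) ≡ true
All>1⇒1∉ᵇ []                  = refl
All>1⇒1∉ᵇ (s≤s (s≤s _) ∷ c>1) = All>1⇒1∉ᵇ c>1

All>1⇒stirlingAt-1 : ∀ {c} → All (1 <_) c → stirlingAt 1 c ≡ true
All>1⇒stirlingAt-1 []                = refl
All>1⇒stirlingAt-1 {y ∷ c} (_ ∷ c>1) =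
  cong₂ (λ b s → (b ∨ (y ≤ᵇ 1)) ∧ s) (All>1⇒1∉ᵇ c>1) (All>1⇒stirlingAt-1 c>1)

isStirling-ones-++ : ∀ j {c} → All (1 <_) c → isStirling (replicate j 1 ++ c) ≡ isStirling c
isStirling-ones-++ zero    c>1 = refl
isStirling-ones-++ (suc j) c>1 =
  cong₂ _∧_ (trans (stirlingAt-ones-++ 0 j _) (All>1⇒stirlingAt-1 c>1)) (isStirling-ones-++ j c>1)

1∉ᵇ⇒All>1 : ∀ {r} → All (1 ≤_) r → T (1 ∉ᵇ r) → All (1 <_) r
1∉ᵇ⇒All>1 []                              _   = []
1∉ᵇ⇒All>1 {suc zero ∷ r}    (_ ∷ _)   ()
1∉ᵇ⇒All>1 {suc (suc _) ∷ r} (_ ∷ r≥1) 1∉r = s≤s (s≤s z≤n) ∷ 1∉ᵇ⇒All>1 r≥1 1∉r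

ones-prefix : ∀ {r} → All (1 ≤_) r → T (stirlingAt 1 r) →
  ∃₂ λ j c → All (1 <_) c × r ≡ replicate j 1 ++ c
ones-prefix []                          _ = 0 , [] , [] , refl
ones-prefix {suc zero ∷ r}    (_ ∷ r≥1) s
  with j , c , c>1 , refl ← ones-prefix r≥1 (proj₂ (Equivalence.to T-∧ s)) = suc j , c , c>1 , refl
ones-prefix {suc (suc y) ∷ r} (_ ∷ r≥1) s =
  0 , _ , s≤s (s≤s z≤n) ∷ 1∉ᵇ⇒All>1 r≥1 1∉r , refl
  where
  1∉r : T (1 ∉ᵇ r)
  1∉r = subst T (∨-identityʳ (1 ∉ᵇ r)) (proj₁ (Equivalence.to T-∧ s))

map-suc-All>1 : ∀ {w} → All (1 ≤_) w → All (1 <_) (map suc w)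
map-suc-All>1 w≥1 = All.map⁺ (All.map s≤s w≥1)

All>1⇒map-suc : ∀ {c} → All (1 <_) c → ∃ λ w → All (1 ≤_) w × c ≡ map suc w
All>1⇒map-suc []                 = [] , [] , refl
All>1⇒map-suc (s≤s 1≤x ∷ c>1) with w , w≥1 , refl ← All>1⇒map-suc c>1 =
  _ ∷ w , 1≤x ∷ w≥1 , refl

descents-map-suc : ∀ w → descents (map suc w) ≡ descents w
descents-map-suc []          = refl
descents-map-suc (x ∷ [])    = refl
descents-map-suc (x ∷ y ∷ w) = cong ((if y <ᵇ x then 1 else 0) +_) (descents-map-suc (y ∷ w))

descents≤length : ∀ w → descents w ≤ length w
descents≤length []          = z≤n
descents≤length (x ∷ [])    = z≤n
descents≤length (x ∷ y ∷ w) = step (y <ᵇ x) (descents≤length (y ∷ w))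
  where
  step : ∀ b {d l} → d ≤ l → (if b then 1 else 0) + d ≤ suc l
  step true  = s≤s
  step false = m≤n⇒m≤1+n

descents-ones-++ : ∀ j {c} → All (1 <_) c → descents (replicate (suc j) 1 ++ c) ≡ descents c
descents-ones-++ zero    []                = refl
descents-ones-++ zero    (s≤s (s≤s _) ∷ _) = refl
descents-ones-++ (suc j) c>1               = descents-ones-++ j c>1

-- Removing and reinserting the block of 1s

module BlockInsertion (m-1 : ℕ) where

  m : ℕ
  m = suc m-1

  block : List ℕ
  block = replicate m 1

  insert : ℕ → List ℕ → List ℕ
  insert zero    c       = block ++ c
  insert (suc p) []      = insert zero []
  insert (suc p) (x ∷ c) = x ∷ insert p c

  insert-↭ : ∀ p c → insert p c ↭ block ++ c
  insert-↭ zero    c       = ↭-refl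
  insert-↭ (suc p) []      = ↭-refl
  insert-↭ (suc p) (x ∷ c) = ↭-trans (↭-prep x (insert-↭ p c)) (↭-sym (shift x block c))

  length-insert : ∀ p c → length (insert p c) ≡ m + length c
  length-insert p c =
    trans (↭-length (insert-↭ p c)) (trans (length-++ block) (cong (_+ length c) (length-replicate m)))

  All-insert⁺ : ∀ {P : ℕ → Set} p {c} → P 1 → All P c → All P (insert p c)
  All-insert⁺ p {c} P1 Pc = All-resp-↭ (↭-sym (insert-↭ p c)) (All.++⁺ (All.replicate⁺ m P1) Pc)

  All-insert⁻ : ∀ {P : ℕ → Set} p {c} → All P (insert p c) → All P c
  All-insert⁻ p {c} P-insert = All.++⁻ʳ block (All-resp-↭ (insert-↭ p c) P-insert)

  occ-insert : ∀ i p c → occ i (insert p c) ≡ occ i block + occ i c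
  occ-insert i p c = trans (occ-↭ i (insert-↭ p c)) (occ-++ i block c)

  ∉ᵇ-insert : ∀ x p c → (suc (suc x) ∉ᵇ insert p c) ≡ (suc (suc x) ∉ᵇ c)
  ∉ᵇ-insert x zero    c       = ∉ᵇ-ones-++ x m c
  ∉ᵇ-insert x (suc p) []      = ∉ᵇ-insert x zero []
  ∉ᵇ-insert x (suc p) (y ∷ c) = cong (not (suc (suc x) ≡ᵇ y) ∧_) (∉ᵇ-insert x p c)

  stirlingAt-insert : ∀ x p c → stirlingAt (suc (suc x)) (insert p c) ≡ stirlingAt (suc (suc x)) c
  stirlingAt-insert x zero    c       = stirlingAt-ones-++ (suc x) m c
  stirlingAt-insert x (suc p) []      = stirlingAt-insert x zero []
  stirlingAt-insert x (suc p) (y ∷ c) =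
    cong₂ (λ b s → (b ∨ (y ≤ᵇ suc (suc x))) ∧ s) (∉ᵇ-insert x p c) (stirlingAt-insert x p c)

  isStirling-insert : ∀ p {c} → All (1 <_) c → isStirling (insert p c) ≡ isStirling c
  isStirling-insert zero    c>1                     = isStirling-ones-++ m c>1
  isStirling-insert (suc p) []                      = isStirling-insert zero []
  isStirling-insert (suc p) {x ∷ c} (s≤s (s≤s _) ∷ c>1) =
    cong₂ _∧_ (stirlingAt-insert _ p c) (isStirling-insert p c>1)

  insert-injective : ∀ p q {c d} → All (1 <_) c → All (1 <_) d → p ≤ length c → q ≤ length d →
    insert p c ≡ insert q d → p ≡ q × c ≡ d
  insert-injective zero    zero    {c} {d} _ _ _ _ eq = refl , ++-cancelˡ block c d eq
  insert-injective zero    (suc q) _ (s≤s (s≤s _) ∷ _) _ (s≤s _) ()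
  insert-injective (suc p) zero    (s≤s (s≤s _) ∷ _) _ (s≤s _) _ ()
  insert-injective (suc p) (suc q) (_ ∷ c>1) (_ ∷ d>1) (s≤s p≤c) (s≤s q≤d) eq
    with refl , eq′ ← ∷-injective eq
    with refl , refl ← insert-injective p q c>1 d>1 p≤c q≤d eq′ = refl , refl

  insert-surjective : ∀ {w} → All (1 ≤_) w → T (isStirling w) → occ 1 w ≡ m →
    ∃₂ λ p c → All (1 <_) c × p ≤ length c × w ≡ insert p c
  insert-surjective {suc zero ∷ r} (_ ∷ r≥1) stirling occ≡m
    with j , c , c>1 , refl ← ones-prefix r≥1 (proj₁ (Equivalence.to T-∧ stirling))
    with refl ← trans (sym (occ-ones-++ j c>1)) (suc-injective occ≡m) =
      0 , c , c>1 , z≤n , refl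
  insert-surjective {suc (suc x) ∷ w} (_ ∷ w≥1) stirling occ≡m
    with p , c , c>1 , p≤c , refl ← insert-surjective w≥1 (proj₂ (Equivalence.to T-∧ stirling)) occ≡m =
      suc p , suc (suc x) ∷ c , s≤s (s≤s z≤n) ∷ c>1 , s≤s p≤c , refl

  insertions : List ℕ → List (List ℕ)
  insertions c = applyUpTo (λ p → insert p c) (suc (length c))

  -- For x ∷ y ∷ c, the gap right after x gives x 1⋯1 y ⋯ with one descent more than y ∷ c,
  -- and every later gap adds the descent [y < x] to an insertion into y ∷ c.
  descents-after-block : ∀ {c} → All (1 <_) c →
    applyUpTo (λ p → descents (insert (suc p) c)) (length c)
      ↭ replicate (descents c) (descents c) ++ replicate (length c ∸ descents c) (suc (descents c))
  descents-after-block []                 = ↭-refl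
  descents-after-block (s≤s (s≤s _) ∷ []) = ↭-reflexive (cong (λ d → suc d ∷ []) (descents-ones-++ m-1 []))
  descents-after-block {x ∷ y ∷ c} (s≤s (s≤s _) ∷ y∷c>1) =
    ↭-trans (↭-reflexive (cong₂ _∷_ (cong suc (descents-ones-++ m-1 y∷c>1))
                                     (sym (map-applyUpTo (λ p → descents (insert (suc p) (y ∷ c)))
                                                         ((if y <ᵇ x then 1 else 0) +_) (length (y ∷ c))))))
      (step (y <ᵇ x) (descents≤length (y ∷ c)) (descents-after-block y∷c>1))
    where
    step : ∀ b {d L} {ds : List ℕ} → d ≤ L →
      ds ↭ replicate d d ++ replicate (L ∸ d) (suc d) →
      let d′ = (if b then 1 else 0) + d in
      suc d ∷ map ((if b then 1 else 0) +_) ds ↭ replicate d′ d′ ++ replicate (suc L ∸ d′) (suc d′)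
    step true  {d} {L} _ ds↭ =
      ↭-prep (suc d) (↭-trans (↭-map⁺ suc ds↭) (↭-reflexive
        (trans (map-++ suc (replicate d d) _)
               (cong₂ _++_ (map-replicate suc d d) (map-replicate suc (L ∸ d) (suc d))))))
    step false {d} {L} d≤L ds↭ =
      ↭-trans (↭-prep (suc d) (↭-trans (↭-reflexive (map-id _)) ds↭))
        (↭-trans (↭-sym (shift (suc d) (replicate d d) (replicate (L ∸ d) (suc d))))
          (↭-reflexive (cong (λ k → replicate d d ++ replicate k (suc d)) (sym (+-∸-assoc 1 d≤L)))))

  descents-insertions : ∀ {c} → All (1 <_) c →
    map descents (insertions c)
      ↭ replicate (suc (descents c)) (descents c) ++ replicate (length c ∸ descents c) (suc (descents c))
  descents-insertions {c} c>1 =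
    ↭-trans (↭-reflexive (trans (map-applyUpTo (λ p → insert p c) descents (suc (length c)))
                                (cong (_∷ applyUpTo (λ p → descents (insert (suc p) c)) (length c))
                                      (descents-ones-++ m-1 c>1))))
            (↭-prep (descents c) (descents-after-block c>1))

  count-descents-insertions : ∀ k {c} → All (1 <_) c →
    length (filterᵇ (λ w → descents w ≡ᵇ k) (insertions c))
      ≡ (if descents c ≡ᵇ k then suc k else 0) + (if suc (descents c) ≡ᵇ k then length c ∸ pred k else 0)
  count-descents-insertions k {c} c>1 = begin
    length (filterᵇ (λ w → descents w ≡ᵇ k) (insertions c))
      ≡⟨ sym (length-filterᵇ-map (_≡ᵇ k) descents (insertions c)) ⟩
    length (filterᵇ (_≡ᵇ k) (map descents (insertions c)))
      ≡⟨ length-filterᵇ-↭ (_≡ᵇ k) (descents-insertions c>1) ⟩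
    length (filterᵇ (_≡ᵇ k) (replicate (suc d) d ++ replicate (length c ∸ d) (suc d)))
      ≡⟨ length-filterᵇ-++ (_≡ᵇ k) (replicate (suc d) d) _ ⟩
    length (filterᵇ (_≡ᵇ k) (replicate (suc d) d))
      + length (filterᵇ (_≡ᵇ k) (replicate (length c ∸ d) (suc d)))
      ≡⟨ cong₂ _+_ (trans (length-filterᵇ-replicate k (suc d) d) (if-≡ᵇ-subst d k suc))
                   (trans (length-filterᵇ-replicate k _ (suc d))
                          (if-≡ᵇ-subst (suc d) k (λ s → length c ∸ pred s))) ⟩
    (if d ≡ᵇ k then suc k else 0) + (if suc d ≡ᵇ k then length c ∸ pred k else 0) ∎
    where
    open ≡-Reasoning

    d : ℕ
    d = descents c

  length-insert-map-suc : ∀ p w → length (insert p (map suc w)) ≡ m + length w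
  length-insert-map-suc p w = trans (length-insert p (map suc w)) (cong (m +_) (length-map suc w))

  isMultisetPerm-insert : ∀ n p {w} → All (1 ≤_) w →
    isMultisetPerm m (suc n) (insert p (map suc w)) ≡ isMultisetPerm m n w
  isMultisetPerm-insert n p {w} w≥1 =
    trans (isMultisetPerm-suc m n (insert p (map suc w)))
      (trans (cong₂ _∧_ (trans (cong (_≡ᵇ m) blockOnes) (Equivalence.to T-≡ (≡⇒≡ᵇ m m refl)))
                        (cong and (map-cong higher (upTo n))))
             (sym (isMultisetPerm-upTo m n w)))
    where
    blockOnes : occ 1 (insert p (map suc w)) ≡ m
    blockOnes = trans (occ-insert 1 p (map suc w))
      (trans (cong₂ _+_ (occ-replicate 1 m 1) (trans (occ-map-suc 0 w) (occ-absent w≥1))) (+-identityʳ m))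

    higher : ∀ j → (occ (suc (suc j)) (insert p (map suc w)) ≡ᵇ m) ≡ (occ (suc j) w ≡ᵇ m)
    higher j = cong (_≡ᵇ m) (trans (occ-insert (suc (suc j)) p (map suc w))
      (trans (cong (_+ occ (suc (suc j)) (map suc w)) (occ-replicate (suc (suc j)) m 1))
             (occ-map-suc (suc j) w)))

  isStirlingPerm : ℕ → List ℕ → Bool
  isStirlingPerm n w = isMultisetPerm m n w ∧ isStirling w

  isStirlingPerm-insert : ∀ n p {w} → All (1 ≤_) w →
    isStirlingPerm (suc n) (insert p (map suc w)) ≡ isStirlingPerm n w
  isStirlingPerm-insert n p {w} w≥1 = cong₂ _∧_ (isMultisetPerm-insert n p w≥1)
    (trans (isStirling-insert p (map-suc-All>1 w≥1)) (isStirling-map-suc w))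

  stirlingPerms : ℕ → List (List ℕ)
  stirlingPerms n = filterᵇ (isStirlingPerm n) (wordList (m * n) n)

  IsStirlingPerm : ℕ → List ℕ → Set
  IsStirlingPerm n w = (length w ≡ m * n × All (Letter n) w) × T (isStirlingPerm n w)

  ∈-stirlingPerms : ∀ n {w} → w ∈ stirlingPerms n ⇔ IsStirlingPerm n w
  ∈-stirlingPerms n = mk⇔
    (λ w∈ → let w∈words , t = ∈-filter⁻ (T? ∘ isStirlingPerm n) {xs = wordList (m * n) n} w∈
            in Equivalence.to (∈-wordList (m * n) n) w∈words , t)
    (λ (w∈words , t) →
      ∈-filter⁺ (T? ∘ isStirlingPerm n) (Equivalence.from (∈-wordList (m * n) n) w∈words) t)

  IsStirlingPerm-insert : ∀ n p {w} → IsStirlingPerm n w → IsStirlingPerm (suc n) (insert p (map suc w))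
  IsStirlingPerm-insert n p {w} ((length≡ , letters) , t) =
    ( trans (length-insert-map-suc p w) (trans (cong (m +_) length≡) (sym (*-suc m n)))
    , All-insert⁺ p (s≤s z≤n , s≤s z≤n) (All.map⁺ (All.map Letter-suc letters)) )
    , subst T (sym (isStirlingPerm-insert n p (All.map proj₁ letters))) t

  IsStirlingPerm-remove : ∀ n {w} → IsStirlingPerm (suc n) w →
    ∃₂ λ p w′ → IsStirlingPerm n w′ × p ≤ length (map suc w′) × w ≡ insert p (map suc w′)
  IsStirlingPerm-remove n {w} ((length≡ , letters) , t)
    with multiset , stirling ← Equivalence.to T-∧ t
    with p , c , c>1 , p≤c , refl ← insert-surjective (All.map proj₁ letters) stirling
                                      (≡ᵇ⇒≡ _ m (proj₁ (Equivalence.to T-∧ multiset)))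
    with w′ , w′≥1 , refl ← All>1⇒map-suc c>1 =
      p , w′ , ((length′ , letters′) , subst T (isStirlingPerm-insert n p w′≥1) t) , p≤c , refl
    where
    length′ : length w′ ≡ m * n
    length′ =
      +-cancelˡ-≡ m _ _ (trans (sym (length-insert-map-suc p w′)) (trans length≡ (*-suc m n)))

    letters′ : All (Letter n) w′
    letters′ = All.zipWith (λ (1≤x , L) → Letter-pred 1≤x L) (w′≥1 , All.map⁻ (All-insert⁻ p letters))

  extensions : ℕ → List (List ℕ)
  extensions n = concatMap (insertions ∘ map suc) (stirlingPerms n)

  ∈-stirlingPerms-suc : ∀ n {w} → w ∈ stirlingPerms (suc n) ⇔ w ∈ extensions n
  ∈-stirlingPerms-suc n = mk⇔ to from
    where
    to : ∀ {w} → w ∈ stirlingPerms (suc n) → w ∈ extensions n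
    to w∈
      with p , w′ , w′-perm , p≤ , refl ←
             IsStirlingPerm-remove n (Equivalence.to (∈-stirlingPerms (suc n)) w∈) =
        ∈-concatMap⁺ (insertions ∘ map suc) {xs = stirlingPerms n}
          (lose (Equivalence.from (∈-stirlingPerms n) w′-perm)
                (∈-applyUpTo⁺ (λ q → insert q (map suc w′)) (s≤s p≤)))

    from : ∀ {w} → w ∈ extensions n → w ∈ stirlingPerms (suc n)
    from w∈
      with w′ , w′∈ , w∈ins ← find (∈-concatMap⁻ (insertions ∘ map suc) {xs = stirlingPerms n} w∈)
      with p , _ , refl ← ∈-applyUpTo⁻ (λ q → insert q (map suc w′)) w∈ins =
        Equivalence.from (∈-stirlingPerms (suc n))
          (IsStirlingPerm-insert n p (Equivalence.to (∈-stirlingPerms n) w′∈))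

  letters≥1 : ∀ n {w} → w ∈ stirlingPerms n → All (1 ≤_) w
  letters≥1 n w∈ = All.map proj₁ (proj₂ (proj₁ (Equivalence.to (∈-stirlingPerms n) w∈)))

  Unique-stirlingPerms : ∀ n → Unique (stirlingPerms n)
  Unique-stirlingPerms n = Unique-filter⁺ (T? ∘ isStirlingPerm n) (Unique-wordList (m * n) n)

  Unique-insertions : ∀ {c} → All (1 <_) c → Unique (insertions c)
  Unique-insertions {c} c>1 = applyUpTo⁺₁ (λ p → insert p c) (suc (length c)) λ i<j j≤c eq →
    <⇒≢ i<j (proj₁ (insert-injective _ _ c>1 c>1
                      (≤-pred (≤-trans i<j (m≤n⇒m≤1+n (≤-pred j≤c)))) (≤-pred j≤c) eq))

  Unique-extensions : ∀ n → Unique (extensions n)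
  Unique-extensions n = Unique-concatMap (insertions ∘ map suc) (Unique-stirlingPerms n)
    (λ w∈ → Unique-insertions (map-suc-All>1 (letters≥1 n w∈)))
    sameBase
    where
    sameBase : ∀ {x y z} → x ∈ stirlingPerms n → y ∈ stirlingPerms n →
      z ∈ insertions (map suc x) → z ∈ insertions (map suc y) → x ≡ y
    sameBase {x} {y} x∈ y∈ z∈x z∈y
      with p , p≤x , refl ← ∈-applyUpTo⁻ (λ p → insert p (map suc x)) z∈x
      with q , q≤y , eq ← ∈-applyUpTo⁻ (λ q → insert q (map suc y)) z∈y =
        map-injective suc-injective (proj₂ (insert-injective p q
          (map-suc-All>1 (letters≥1 n x∈)) (map-suc-All>1 (letters≥1 n y∈))
          (≤-pred p≤x) (≤-pred q≤y) eq))

  length-stirlingPerm : ∀ n {w} → w ∈ stirlingPerms n → length w ≡ m * n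
  length-stirlingPerm n w∈ = proj₁ (proj₁ (Equivalence.to (∈-stirlingPerms n) w∈))

  eulerian : ℕ → ℕ → ℕ
  eulerian n k = length (filterᵇ (λ w → descents w ≡ᵇ k) (stirlingPerms n))

  -- For k = 0 the last count is 0, so the truncation pred 0 = 0 is harmless.
  eulerian-suc : ∀ n k → eulerian (suc n) k ≡
    suc k * eulerian n k
      + (m * n ∸ pred k) * length (filterᵇ (λ w → suc (descents w) ≡ᵇ k) (stirlingPerms n))
  eulerian-suc n k = begin
    eulerian (suc n) k
      ≡⟨ unique∧set⇒length-filterᵇ-≡ hasK (Unique-stirlingPerms (suc n)) (Unique-extensions n)
                                       (∈-stirlingPerms-suc n) ⟩
    length (filterᵇ hasK (extensions n))
      ≡⟨ length-filterᵇ-concatMap hasK (insertions ∘ map suc) (stirlingPerms n) ⟩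
    sum (map (λ w → length (filterᵇ hasK (insertions (map suc w)))) (stirlingPerms n))
      ≡⟨ cong sum (map-cong-local (All.tabulate countPerWord)) ⟩
    sum (map (λ w → keep w + raise w) (stirlingPerms n))
      ≡⟨ sum-map-+ keep raise (stirlingPerms n) ⟩
    sum (map keep (stirlingPerms n)) + sum (map raise (stirlingPerms n))
      ≡⟨ cong₂ _+_ (sum-map-if hasK (suc k) (stirlingPerms n))
                   (sum-map-if (λ w → suc (descents w) ≡ᵇ k) (m * n ∸ pred k) (stirlingPerms n)) ⟩
    suc k * eulerian n k
      + (m * n ∸ pred k) * length (filterᵇ (λ w → suc (descents w) ≡ᵇ k) (stirlingPerms n)) ∎
    where
    open ≡-Reasoning

    hasK : List ℕ → Bool
    hasK w = descents w ≡ᵇ k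

    keep raise : List ℕ → ℕ
    keep  w = if descents w ≡ᵇ k then suc k else 0
    raise w = if suc (descents w) ≡ᵇ k then m * n ∸ pred k else 0

    countPerWord : ∀ {w} → w ∈ stirlingPerms n →
      length (filterᵇ hasK (insertions (map suc w))) ≡ keep w + raise w
    countPerWord {w} w∈ =
      trans (count-descents-insertions k (map-suc-All>1 (letters≥1 n w∈)))
        (cong₂ (λ d L → (if d ≡ᵇ k then suc k else 0) + (if suc d ≡ᵇ k then L ∸ pred k else 0))
               (descents-map-suc w) (trans (length-map suc w) (length-stirlingPerm n w∈)))

  eulerian-suc-zero : ∀ n → eulerian (suc n) 0 ≡ eulerian n 0
  eulerian-suc-zero n = begin
    eulerian (suc n) 0
      ≡⟨ eulerian-suc n 0 ⟩
    1 * eulerian n 0 + (m * n ∸ 0) * length (filterᵇ (λ w → suc (descents w) ≡ᵇ 0) (stirlingPerms n))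
      ≡⟨ cong (λ xs → 1 * eulerian n 0 + (m * n ∸ 0) * length xs) noneBelowOne ⟩
    1 * eulerian n 0 + (m * n ∸ 0) * 0
      ≡⟨ cong₂ _+_ (*-identityˡ (eulerian n 0)) (*-zeroʳ (m * n ∸ 0)) ⟩
    eulerian n 0 + 0
      ≡⟨ +-identityʳ (eulerian n 0) ⟩
    eulerian n 0 ∎
    where
    open ≡-Reasoning

    noneBelowOne : filterᵇ (λ w → suc (descents w) ≡ᵇ 0) (stirlingPerms n) ≡ []
    noneBelowOne =
      filter-none (T? ∘ (λ w → suc (descents w) ≡ᵇ 0)) {xs = stirlingPerms n} (All.tabulate (λ _ ()))

  eulerian-suc-suc : ∀ n k →
    eulerian (suc n) (suc k) ≡ suc (suc k) * eulerian n (suc k) + (m * n ∸ k) * eulerian n k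
  eulerian-suc-suc n k = eulerian-suc n (suc k)

  stirlingPerms-zero : stirlingPerms 0 ≡ [ [] ]
  stirlingPerms-zero = cong (λ L → filterᵇ (isStirlingPerm 0) (wordList L 0)) (*-zeroʳ m)

  eulerian-zero-zero : eulerian 0 0 ≡ 1
  eulerian-zero-zero = cong (λ xs → length (filterᵇ (λ w → descents w ≡ᵇ 0) xs)) stirlingPerms-zero

  eulerian-zero-suc : ∀ k → eulerian 0 (suc k) ≡ 0
  eulerian-zero-suc k = cong (λ xs → length (filterᵇ (λ w → descents w ≡ᵇ suc k) xs)) stirlingPerms-zero

  Eul≡eulerian : ∀ n k → Eul m n k ≡ eulerian n k
  Eul≡eulerian n k = begin
    Eul m n k
      ≡⟨ cong length (filterᵇ-cong (λ a → cong (λ s → (isMultisetPerm m n (toList a) ∧ s) ∧ hasK (toList a))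
                                             (isStirlingCond-toList a))
                                   (words (m * n) n)) ⟩
    length (filterᵇ (P ∘ toList) (words (m * n) n))
      ≡⟨ sym (length-filterᵇ-map P toList (words (m * n) n)) ⟩
    length (filterᵇ P (map toList (words (m * n) n)))
      ≡⟨ cong (length ∘ filterᵇ P) (map-toList-words (m * n) n) ⟩
    length (filterᵇ P (wordList (m * n) n))
      ≡⟨ cong length (filterᵇ-∧ (isStirlingPerm n) hasK (wordList (m * n) n)) ⟩
    eulerian n k ∎
    where
    open ≡-Reasoning

    hasK : List ℕ → Bool
    hasK w = descents w ≡ᵇ k

    P : List ℕ → Bool
    P w = isStirlingPerm n w ∧ hasK w

-- Solving the recurrence

prodFormula-suc : ∀ m n → prodFormula m (suc (suc n)) ≡ prodFormula m (suc n) * (suc n * (m ∸ 1) + 1)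
prodFormula-suc m n = begin
  product (map f (map suc (upTo (suc n))))
    ≡⟨ cong (λ xs → product (map f (map suc xs))) (sym (upTo-∷ʳ n)) ⟩
  product (map f (map suc (upTo n ++ [ n ])))
    ≡⟨ cong product (trans (cong (map f) (map-++ suc (upTo n) [ n ]))
                           (map-++ f (map suc (upTo n)) [ suc n ])) ⟩
  product (map f (map suc (upTo n)) ++ [ f (suc n) ])
    ≡⟨ product-++ (map f (map suc (upTo n))) [ f (suc n) ] ⟩
  prodFormula m (suc n) * (f (suc n) * 1)
    ≡⟨ cong (prodFormula m (suc n) *_) (*-identityʳ (f (suc n))) ⟩
  prodFormula m (suc n) * f (suc n) ∎
  where
  open ≡-Reasoning

  f : ℕ → ℕ
  f j = j * (m ∸ 1) + 1

module EulerianRecurrence (m-1 : ℕ) (E : ℕ → ℕ → ℕ)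
  (E-zero-zero : E 0 0 ≡ 1)
  (E-zero-suc  : ∀ k → E 0 (suc k) ≡ 0)
  (E-suc-zero  : ∀ n → E (suc n) 0 ≡ E n 0)
  (E-suc-suc   : ∀ n k → E (suc n) (suc k) ≡ suc (suc k) * E n (suc k) + (suc m-1 * n ∸ k) * E n k)
  where

  private
    m : ℕ
    m = suc m-1

  E-n-zero : ∀ n → E n 0 ≡ 1
  E-n-zero zero    = E-zero-zero
  E-n-zero (suc n) = trans (E-suc-zero n) (E-n-zero n)

  E-vanishes : ∀ n k → n < k → E (suc n) k ≡ 0
  E-vanishes zero (suc k) _ = begin
    E 1 (suc k)
      ≡⟨ E-suc-suc 0 k ⟩
    suc (suc k) * E 0 (suc k) + (m * 0 ∸ k) * E 0 k
      ≡⟨ cong₂ (λ e z → suc (suc k) * e + (z ∸ k) * E 0 k) (E-zero-suc k) (*-zeroʳ m) ⟩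
    suc (suc k) * 0 + (0 ∸ k) * E 0 k
      ≡⟨ cong₂ (λ x y → x + y * E 0 k) (*-zeroʳ (suc (suc k))) (0∸n≡0 k) ⟩
    0 ∎
    where open ≡-Reasoning
  E-vanishes (suc n) (suc k) (s≤s n<k) = begin
    E (suc (suc n)) (suc k)
      ≡⟨ E-suc-suc (suc n) k ⟩
    suc (suc k) * E (suc n) (suc k) + (m * suc n ∸ k) * E (suc n) k
      ≡⟨ cong₂ (λ e e′ → suc (suc k) * e + (m * suc n ∸ k) * e′)
               (E-vanishes n (suc k) (m≤n⇒m≤1+n n<k)) (E-vanishes n k n<k) ⟩
    suc (suc k) * 0 + (m * suc n ∸ k) * 0
      ≡⟨ cong₂ _+_ (*-zeroʳ (suc (suc k))) (*-zeroʳ (m * suc n ∸ k)) ⟩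
    0 ∎
    where open ≡-Reasoning

  E-top : ∀ n → E (suc n) n ≡ prodFormula m (suc n)
  E-top zero    = E-n-zero 1
  E-top (suc n) = begin
    E (suc (suc n)) (suc n)
      ≡⟨ E-suc-suc (suc n) n ⟩
    suc (suc n) * E (suc n) (suc n) + (m * suc n ∸ n) * E (suc n) n
      ≡⟨ cong₂ (λ e x → suc (suc n) * e + x * E (suc n) n) (E-vanishes n (suc n) ≤-refl) factor ⟩
    suc (suc n) * 0 + (suc n * m-1 + 1) * E (suc n) n
      ≡⟨ cong₂ _+_ (*-zeroʳ (suc (suc n))) (cong ((suc n * m-1 + 1) *_) (E-top n)) ⟩
    (suc n * m-1 + 1) * prodFormula m (suc n)
      ≡⟨ *-comm (suc n * m-1 + 1) _ ⟩
    prodFormula m (suc n) * (suc n * m-1 + 1)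
      ≡⟨ sym (prodFormula-suc m n) ⟩
    prodFormula m (suc (suc n)) ∎
    where
    open ≡-Reasoning

    expand : ∀ a n → suc a * suc n ≡ suc n * a + 1 + n
    expand = solve-∀

    factor : m * suc n ∸ n ≡ suc n * m-1 + 1
    factor = trans (cong (_∸ n) (expand m-1 n)) (m+n∸n≡m (suc n * m-1 + 1) n)

  E-one+ : ∀ n → E (suc n) 1 + m * suc (suc n) ≡ m * 2 ^ suc n
  E-one+ zero    = cong (_+ m * 2) (E-vanishes 0 1 (s≤s z≤n))
  E-one+ (suc n) = begin
    E (suc (suc n)) 1 + m * suc (suc (suc n))
      ≡⟨ cong (_+ m * suc (suc (suc n))) (E-suc-suc (suc n) 0) ⟩
    2 * E (suc n) 1 + m * suc n * E (suc n) 0 + m * suc (suc (suc n))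
      ≡⟨ cong (λ e → 2 * E (suc n) 1 + m * suc n * e + m * suc (suc (suc n))) (E-n-zero (suc n)) ⟩
    2 * E (suc n) 1 + m * suc n * 1 + m * suc (suc (suc n))
      ≡⟨ regroup (E (suc n) 1) m n ⟩
    2 * (E (suc n) 1 + m * suc (suc n))
      ≡⟨ cong (2 *_) (E-one+ n) ⟩
    2 * (m * 2 ^ suc n)
      ≡⟨ swap m (2 ^ suc n) ⟩
    m * 2 ^ suc (suc n) ∎
    where
    open ≡-Reasoning

    regroup : ∀ e a n → 2 * e + a * suc n * 1 + a * suc (suc (suc n)) ≡ 2 * (e + a * suc (suc n))
    regroup = solve-∀

    swap : ∀ a x → 2 * (a * x) ≡ a * (2 * x)
    swap = solve-∀

  E-one : ∀ n → E (suc n) 1 ≡ m * (2 ^ suc n ∸ suc n ∸ 1)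
  E-one n = begin
    E (suc n) 1
      ≡⟨ sym (m+n∸n≡m (E (suc n) 1) (m * suc (suc n))) ⟩
    E (suc n) 1 + m * suc (suc n) ∸ m * suc (suc n)
      ≡⟨ cong (_∸ m * suc (suc n)) (E-one+ n) ⟩
    m * 2 ^ suc n ∸ m * suc (suc n)
      ≡⟨ sym (*-distribˡ-∸ m (2 ^ suc n) (suc (suc n))) ⟩
    m * (2 ^ suc n ∸ suc (suc n))
      ≡⟨ cong (λ k → m * (2 ^ suc n ∸ k)) (+-comm 1 (suc n)) ⟩
    m * (2 ^ suc n ∸ (suc n + 1))
      ≡⟨ cong (m *_) (sym (∸-+-assoc (2 ^ suc n) (suc n) 1)) ⟩
    m * (2 ^ suc n ∸ suc n ∸ 1) ∎
    where open ≡-Reasoning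

corollary4p2 : (m n : ℕ) → 1 ≤ m → 1 ≤ n →
    (Eul m n (n ∸ 1) ≡ prodFormula m n) × (Eul m n 1 ≡ m * (2 ^ n ∸ n ∸ 1))
corollary4p2 (suc m-1) (suc n) _ _ =
    trans (Eul≡eulerian (suc n) n) (E-top n)
  , trans (Eul≡eulerian (suc n) 1) (E-one n)
  where
  open BlockInsertion m-1
  open EulerianRecurrence m-1 eulerian eulerian-zero-zero eulerian-zero-suc eulerian-suc-zero eulerian-suc-suc
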